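{- For each $r, k \in \mathbb{N}$ there exist $K = K(r,k) \in \mathbb{N}$ and $\delta = \delta(r,k) > 0$ such that the following holds. Given a vertex set $A \cup B$ (disjoint) with $|A| = |U(r,k)|$ and $|B| = n$, let $$\mathcal{G}(r,k,n) := \big\{ G[A,B] : \text{there exists a } U(r+1,k)\text{ -free graph } G \text{ on } A \cup B \text{ with } G[A] = U(r,k) \big\}.$$ Then $|\mathcal{G}(r,k,n)| \leqslant 2^{|U(r,k)| n - \delta n}$.
   Context: $|U(r,k)|$ denotes the number of vertices of $U(r,k)$, and $G[A,B]$ is the bipartite graph of edges of $G$ between $A$ and $B$. For vertex sets $X, Y$, $X \to Y$ means that for every $S \subseteq Y$ some $x \in X$ has $\Gamma(x) \cap Y = S$. The generalized universal graph $U(r,k)$ is the $r$-partite graph on classes $A_1 \cup \cdots \cup A_r$ (each class independent) with $|A_1| = k$, $|A_{j+1}| = 2^{\sum_{i \leqslant j} |A_i|}$ and $A_{j+1} \to A_1 \cup \cdots \cup A_j$ for $1 \leqslant j \leqslant r-1$. $G[A] = U(r,k)$ means $G[A]$ is (isomorphic to) this graph with a fixed class structure $A = A_1 \cup \cdots \cup A_r$. A graph is $U(r+1,k)$-free if there are no disjoint vertex sets $A'_1, \ldots, A'_{r+1}$ such that the edges between distinct $A'_i$'s form a copy of $U(r+1,k)$ with $A'_i$ corresponding to the $i$-th class. -}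

module Defs where

open import Data.Nat using (ℕ; zero; suc; _+_; _*_; _^_; _≤_; _<_; _<?_)
open import Data.Bool using (Bool; true; false; if_then_else_)
open import Data.Fin using (Fin; toℕ; _↑ˡ_; _↑ʳ_; _≟_)
import Data.Fin as F
open import Data.Maybe using (Maybe; just; nothing)
open import Data.Vec using (Vec; tabulate)
open import Data.Product using (Σ; ∃; _×_)
open import Relation.Nullary using (¬_)
open import Relation.Nullary.Decidable using (⌊_⌋)
open import Relation.Binary.PropositionalEquality using (_≡_)
open import Function using (_∘_)

record Graph (m : ℕ) : Set where
  field
    adj    : Fin m → Fin m → Bool
    sym    : ∀ u v → adj u v ≡ adj v u
    irrefl : ∀ v → adj v v ≡ false
open Graph public

count : ∀ {m} → (Fin m → Bool) → ℕ
count {zero}  f = 0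
count {suc m} f = (if f F.zero then 1 else 0) + count (f ∘ F.suc)

-- |U(r,k)| = |A_1| + ... + |A_r|  (sizes |A_1| = k, |A_{j+1}| = 2^(|A_1|+...+|A_j|))
Usize : ℕ → ℕ → ℕ
Usize zero          k = 0
Usize (suc zero)    k = k
Usize (suc (suc r)) k = Usize (suc r) k + 2 ^ Usize (suc r) k

-- classes are indexed by Fin r (0-based: class i is A_{i+1});
-- a vertex v with cls v ≡ just i lies in class i, cls v ≡ nothing: in no class
inCls : ∀ {r} → Maybe (Fin r) → Fin r → Bool
inCls nothing  i = false
inCls (just j) i = ⌊ j ≟ i ⌋

earlier : ∀ {r} → Maybe (Fin r) → Fin r → Bool
earlier nothing  i = false
earlier (just j) i = ⌊ toℕ j <? toℕ i ⌋

-- X → Y  with X = class i and Y = union of the classes before i: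
-- every S ⊆ Y equals Γ(x) ∩ Y for some x in class i.
Arrow : ∀ {m r} → (Fin m → Fin m → Bool) → (Fin m → Maybe (Fin r)) → Fin r → Set
Arrow {m} a cls i =
  (S : Fin m → Bool) → (∀ v → S v ≡ true → earlier (cls v) i ≡ true) →
  ∃ λ x → inCls (cls x) i ≡ true ×
          (∀ v → earlier (cls v) i ≡ true → a x v ≡ S v)

-- The disjoint classes given by cls, with the edges of a between distinct
-- classes, form a copy of U(r,k) (class i corresponding to A_{i+1}).
IsUCopy : ∀ {m} (r k : ℕ) → (Fin m → Fin m → Bool) → (Fin m → Maybe (Fin r)) → Set
IsUCopy r k a cls =
  (∀ (i : Fin r) → toℕ i ≡ 0 → count (λ v → inCls (cls v) i) ≡ k) ×
  (∀ (i : Fin r) → 0 < toℕ i →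
     (count (λ v → inCls (cls v) i) ≡ 2 ^ count (λ v → earlier (cls v) i))
     × Arrow a cls i)

UFree : ∀ {m} (r k : ℕ) → Graph m → Set
UFree {m} r k G = ¬ Σ (Fin m → Maybe (Fin r)) (IsUCopy r k (adj G))

BipGraph : ℕ → ℕ → Set
BipGraph a n = Vec (Vec Bool n) a

-- vertex set A ∪ B = Fin (a + n): A = the first a vertices (i ↑ˡ n), B = the last n (a ↑ʳ j)
-- G[A,B]
crossPart : ∀ {a n} → Graph (a + n) → BipGraph a n
crossPart {a} {n} G = tabulate (λ i → tabulate (λ j → adj G (i ↑ˡ n) (a ↑ʳ j)))

adjA : ∀ {a n} → Graph (a + n) → Fin a → Fin a → Bool
adjA {a} {n} G u v = adj G (u ↑ˡ n) (v ↑ˡ n)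

IsUOnA : ∀ {a n} (r k : ℕ) → Graph (a + n) → Set
IsUOnA {a} r k G =
  Σ (Fin a → Fin r) λ c →
    IsUCopy r k (adjA G) (just ∘ c) ×
    (∀ u v → c u ≡ c v → adjA G u v ≡ false)

InFamily : (r k n : ℕ) → BipGraph (Usize r k) n → Set
InFamily r k n H =
  ∃ λ (G : Graph (Usize r k + n)) →
    IsUOnA {Usize r k} {n} r k G × UFree (suc r) k G × crossPart {Usize r k} {n} G ≡ H

module Submission where

-- Let N = |U(r,k)| and view G[A,B] through its n columns: the column of b ∈ B is the
-- vector in {0,1}^N recording the A-neighbourhood of b.
--
-- Key step (r ≥ 1): if every vector of {0,1}^N occurs as a column, choose one vertex of
-- B per vector.  These 2^N representatives form a class A_{r+1} with A_{r+1} → A, so G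
-- contains U(r+1,k).  Hence every H ∈ 𝒢(r,k,n) misses some column vector s, and there
-- are at most 2^N (2^N - 1)^n such H.  With M = 2^N, q = 2M, p = 1 and n ≥ N q the
-- estimate 4 (M-1)^q ≤ M^q (from Bernoulli's inequality) turns this into
-- |𝒢|^q 2^n ≤ 2^(N n q).  For r = 0 the family is empty once n ≥ k: any k vertices
-- already form a copy of U(1,k).

open import Defs hiding (sym)
open import Data.Nat using (ℕ; zero; suc; _+_; _*_; _^_; _≤_; _<_; pred; z≤n; s≤s; s≤s⁻¹; _<?_)
open import Data.Nat.Properties
  using (≤-reflexive; ≤-trans; ≤-antisym; n≤1+n; ≤⇒≯; +-assoc; +-identityʳ; *-identityˡ; *-comm;
         +-mono-≤; +-monoʳ-≤; *-mono-≤; *-monoˡ-≤; *-monoʳ-≤; *-cancelˡ-≤; ^-monoˡ-≤; ^-monoʳ-≤;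
         ^-distribˡ-+-*; ^-*-assoc; m^n≢0; suc-pred; module ≤-Reasoning)
open import Data.Nat.Solver using (module +-*-Solver)
open import Data.Bool using (Bool; true; false; if_then_else_)
open import Data.Bool.Properties using (not-¬)
open import Data.Fin using (Fin; toℕ; _↑ˡ_; _↑ʳ_; splitAt; fromℕ; inject₁)
import Data.Fin as F
open import Data.Fin.Properties
  using (splitAt-↑ˡ; splitAt-↑ʳ; splitAt⁻¹-↑ˡ; splitAt⁻¹-↑ʳ; toℕ-inject₁; toℕ-fromℕ; toℕ<n;
         fromℕ≢inject₁; inject₁-injective; suc-injective; ≤fromℕ)
open import Data.Fin.Relation.Unary.Top using (view; ‵fromℕ; ‵inject₁)
open import Data.Maybe using (Maybe; just; nothing)
open import Data.Vec using (Vec; []; _∷_; lookup; tabulate)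
open import Data.Vec.Properties using (lookup∘tabulate; tabulate-cong; ∷-injective; ≡-dec)
open import Data.List using (List; []; _∷_; length; map; concat; filter; cartesianProductWith; allFin)
open import Data.List.Properties using (length-map; length-++; filter-notAll)
open import Data.List.Membership.Propositional using (_∈_)
import Data.List.Membership.Propositional.Properties as Mem
open import Data.List.Relation.Unary.Any as Any using (Any; here; there; any?)
open import Data.List.Relation.Unary.All as All using (All; []; _∷_; all?)
open import Data.List.Relation.Unary.All.Properties using (¬All⇒Any¬)
open import Data.List.Relation.Unary.Unique.Propositional using (Unique)
import Data.List.Relation.Unary.Unique.Propositional.Properties as Uniq
open import Data.List.Relation.Unary.AllPairs using ([]; _∷_)
open import Data.Product using (Σ; ∃; _×_; _,_; proj₁; proj₂)
open import Data.Sum using (_⊎_; inj₁; inj₂; [_,_]′)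
open import Data.Empty using (⊥-elim)
open import Function using (_∘_)
open import Relation.Nullary using (¬_; Dec; yes; no; ¬?)
open import Relation.Nullary.Decidable using (⌊_⌋; isYes≗does; dec-true; dec-false)
open import Relation.Binary.PropositionalEquality
  using (_≡_; _≢_; refl; sym; trans; cong; cong₂; subst; subst₂; module ≡-Reasoning)

private
  variable
    A B C : Set

isYes-true : ∀ {P : Set} (d : Dec P) → P → ⌊ d ⌋ ≡ true
isYes-true d p = trans (isYes≗does d) (dec-true d p)

isYes-false : ∀ {P : Set} (d : Dec P) → ¬ P → ⌊ d ⌋ ≡ false
isYes-false d ¬p = trans (isYes≗does d) (dec-false d ¬p)

isYes-sound : ∀ {P : Set} (d : Dec P) → ⌊ d ⌋ ≡ true → P
isYes-sound (yes p) _ = p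
isYes-sound (no _) ()

isYes-cong : ∀ {P Q : Set} (d : Dec P) (e : Dec Q) → (P → Q) → (Q → P) → ⌊ d ⌋ ≡ ⌊ e ⌋
isYes-cong (yes p) e f g = sym (isYes-true e (f p))
isYes-cong (no ¬p) e f g = sym (isYes-false e (¬p ∘ g))

remove : ∀ {x : A} (ys : List A) → x ∈ ys →
  Σ (List A) λ ys' → length ys ≡ suc (length ys') × (∀ {z} → z ∈ ys → z ≡ x ⊎ z ∈ ys')
remove (y ∷ ys) (here refl) = ys , refl , λ { (here p) → inj₁ p ; (there q) → inj₂ q }
remove (y ∷ ys) (there x∈) with remove ys x∈
... | ys' , len , keep = y ∷ ys' , cong suc len ,
  λ { (here p) → inj₂ (here p) ; (there q) → [ inj₁ , inj₂ ∘ there ]′ (keep q) }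

unique⊆⇒length≤ : ∀ {xs ys : List A} → Unique xs → (∀ {z} → z ∈ xs → z ∈ ys) →
  length xs ≤ length ys
unique⊆⇒length≤ {xs = []} _ _ = z≤n
unique⊆⇒length≤ {xs = x ∷ xs} {ys} (x∉xs ∷ xs!) xs⊆ys with remove ys (xs⊆ys (here refl))
... | ys' , len , keep = subst (suc (length xs) ≤_) (sym len) (s≤s (unique⊆⇒length≤ xs! xs⊆ys'))
  where
  xs⊆ys' : ∀ {z} → z ∈ xs → z ∈ ys'
  xs⊆ys' {z} z∈ with keep (xs⊆ys (there z∈))
  ... | inj₂ z∈ys' = z∈ys'
  ... | inj₁ z≡x  = ⊥-elim (All.lookup x∉xs z∈ (sym z≡x))

length-cartesianProductWith : (f : A → B → C) (xs : List A) (ys : List B) →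
  length (cartesianProductWith f xs ys) ≡ length xs * length ys
length-cartesianProductWith f [] ys = refl
length-cartesianProductWith f (x ∷ xs) ys =
  trans (length-++ (map (f x) ys))
        (cong₂ _+_ (length-map (f x) ys) (length-cartesianProductWith f xs ys))

length-concat-map≤ : (g : A → List B) (xs : List A) (m : ℕ) → (∀ x → length (g x) ≤ m) →
  length (concat (map g xs)) ≤ length xs * m
length-concat-map≤ g [] m _ = z≤n
length-concat-map≤ g (x ∷ xs) m g≤ =
  subst (_≤ m + length xs * m) (sym (length-++ (g x)))
        (+-mono-≤ (g≤ x) (length-concat-map≤ g xs m g≤))

vectorsOver : List A → (n : ℕ) → List (Vec A n)
vectorsOver xs zero    = [] ∷ []
vectorsOver xs (suc n) = cartesianProductWith _∷_ xs (vectorsOver xs n)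

length-vectorsOver : (xs : List A) (n : ℕ) → length (vectorsOver xs n) ≡ length xs ^ n
length-vectorsOver xs zero    = refl
length-vectorsOver xs (suc n) =
  trans (length-cartesianProductWith _∷_ xs (vectorsOver xs n))
        (cong (length xs *_) (length-vectorsOver xs n))

∈-vectorsOver : (xs : List A) {n : ℕ} (v : Vec A n) → (∀ i → lookup v i ∈ xs) →
  v ∈ vectorsOver xs n
∈-vectorsOver xs []      _   = here refl
∈-vectorsOver xs (x ∷ v) v⊆ =
  Mem.∈-cartesianProductWith⁺ _∷_ (v⊆ F.zero) (∈-vectorsOver xs v (v⊆ ∘ F.suc))

unique-vectorsOver : (xs : List A) (n : ℕ) → Unique xs → Unique (vectorsOver xs n)
unique-vectorsOver xs zero    _   = [] ∷ []
unique-vectorsOver xs (suc n) xs! =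
  Uniq.cartesianProductWith⁺ _∷_ ∷-injective xs! (unique-vectorsOver xs n xs!)

booleanVectors : (N : ℕ) → List (Vec Bool N)
booleanVectors = vectorsOver (true ∷ false ∷ [])

∈-booleanVectors : ∀ {N} (v : Vec Bool N) → v ∈ booleanVectors N
∈-booleanVectors v = ∈-vectorsOver _ v (λ i → ∈-bools (lookup v i))
  where
  ∈-bools : ∀ b → b ∈ true ∷ false ∷ []
  ∈-bools true  = here refl
  ∈-bools false = there (here refl)

unique-booleanVectors : ∀ N → Unique (booleanVectors N)
unique-booleanVectors N = unique-vectorsOver _ N (((λ ()) ∷ []) ∷ [] ∷ [])

length-booleanVectors : ∀ N → length (booleanVectors N) ≡ 2 ^ N
length-booleanVectors N = length-vectorsOver _ N

_≟V_ : ∀ {N} → (u v : Vec Bool N) → Dec (u ≡ v)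
_≟V_ = ≡-dec Data.Bool._≟_

surjective-or-misses : ∀ {n N} (f : Fin n → Vec Bool N) →
  (∀ s → ∃ λ j → f j ≡ s) ⊎ (∃ λ s → ∀ j → f j ≢ s)
surjective-or-misses {n} {N} f = decide (all? occurs? (booleanVectors N))
  where
  occurs? : ∀ s → Dec (Any (λ j → f j ≡ s) (allFin n))
  occurs? s = any? (λ j → f j ≟V s) (allFin n)
  decide : Dec (All (λ s → Any (λ j → f j ≡ s) (allFin n)) (booleanVectors N)) →
    (∀ s → ∃ λ j → f j ≡ s) ⊎ (∃ λ s → ∀ j → f j ≢ s)
  decide (yes all-occur) = inj₁ λ s → Any.satisfied (All.lookup all-occur (∈-booleanVectors s))
  decide (no ¬all-occur) with Any.satisfied (¬All⇒Any¬ occurs? (booleanVectors N) ¬all-occur)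
  ... | s , ¬occurs = inj₂ (s , λ j fj≡s → ¬occurs (Any.map (λ { refl → fj≡s }) (Mem.∈-allFin j)))

count-cong : ∀ {m} (f g : Fin m → Bool) → (∀ v → f v ≡ g v) → count f ≡ count g
count-cong {zero}  f g f≗g = refl
count-cong {suc m} f g f≗g =
  cong₂ _+_ (cong (λ b → if b then 1 else 0) (f≗g F.zero))
            (count-cong (f ∘ F.suc) (g ∘ F.suc) (f≗g ∘ F.suc))

count-false : ∀ m → count {m} (λ _ → false) ≡ 0
count-false zero    = refl
count-false (suc m) = count-false m

count-true : ∀ m → count {m} (λ _ → true) ≡ m
count-true zero    = refl
count-true (suc m) = cong suc (count-true m)

count-+ : ∀ N {n} (f : Fin (N + n) → Bool) →
  count f ≡ count (λ a → f (a ↑ˡ n)) + count (λ j → f (N ↑ʳ j))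
count-+ zero    f = refl
count-+ (suc N) f = trans (cong ((if f F.zero then 1 else 0) +_) (count-+ N (f ∘ F.suc)))
                          (sym (+-assoc (if f F.zero then 1 else 0) _ _))

+-elim : ∀ N {n} (P : Fin (N + n) → Set) →
  (∀ a → P (a ↑ˡ n)) → (∀ j → P (N ↑ʳ j)) → ∀ v → P v
+-elim N P left right v with splitAt N v in eq
... | inj₁ a = subst P (splitAt⁻¹-↑ˡ eq) (left a)
... | inj₂ j = subst P (splitAt⁻¹-↑ʳ {N} eq) (right j)

truePositions : ∀ {m} → (Fin m → Bool) → List (Fin m)
truePositions {zero}  f = []
truePositions {suc m} f = if f F.zero then F.zero ∷ rest else rest
  where
  rest : List (Fin (suc m))
  rest = map F.suc (truePositions (f ∘ F.suc))

length-truePositions : ∀ {m} (f : Fin m → Bool) → length (truePositions f) ≡ count f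
length-truePositions {zero}  f = refl
length-truePositions {suc m} f with f F.zero
... | true  = cong suc (trans (length-map F.suc (truePositions (f ∘ F.suc)))
                             (length-truePositions (f ∘ F.suc)))
... | false = trans (length-map F.suc (truePositions (f ∘ F.suc)))
                    (length-truePositions (f ∘ F.suc))

unique-truePositions : ∀ {m} (f : Fin m → Bool) → Unique (truePositions f)
unique-truePositions {zero}  f = []
unique-truePositions {suc m} f with f F.zero
... | true  = All.tabulate zero∉ ∷ Uniq.map⁺ suc-injective (unique-truePositions (f ∘ F.suc))
  where
  zero∉ : ∀ {j} → j ∈ map F.suc (truePositions (f ∘ F.suc)) → F.zero ≢ j
  zero∉ j∈ refl with Mem.∈-map⁻ F.suc j∈
  ... | _ , _ , ()
... | false = Uniq.map⁺ suc-injective (unique-truePositions (f ∘ F.suc))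

∈-truePositions⁺ : ∀ {m} (f : Fin m → Bool) j → f j ≡ true → j ∈ truePositions f
∈-truePositions⁺ {suc m} f F.zero fj rewrite fj = here refl
∈-truePositions⁺ {suc m} f (F.suc j) fj with f F.zero
... | true  = there (Mem.∈-map⁺ F.suc (∈-truePositions⁺ (f ∘ F.suc) j fj))
... | false = Mem.∈-map⁺ F.suc (∈-truePositions⁺ (f ∘ F.suc) j fj)

∈-truePositions⁻ : ∀ {m} (f : Fin m → Bool) j → j ∈ truePositions f → f j ≡ true
∈-truePositions⁻ {suc m} f j j∈ with f F.zero in f0
∈-truePositions⁻ {suc m} f j (here refl) | true = f0
∈-truePositions⁻ {suc m} f j (there j∈) | true with Mem.∈-map⁻ F.suc j∈
... | j' , j'∈ , refl = ∈-truePositions⁻ (f ∘ F.suc) j' j'∈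
∈-truePositions⁻ {suc m} f j j∈ | false with Mem.∈-map⁻ F.suc j∈
... | j' , j'∈ , refl = ∈-truePositions⁻ (f ∘ F.suc) j' j'∈

-- If rep is a right inverse of f : Fin n → {0,1}^N, exactly 2^N positions j are
-- "representatives", i.e. satisfy rep (f j) = j: they are the image of rep.
count-representatives : ∀ {n N} (f : Fin n → Vec Bool N) (rep : Vec Bool N → Fin n) →
  (∀ s → f (rep s) ≡ s) → count (λ j → ⌊ rep (f j) F.≟ j ⌋) ≡ 2 ^ N
count-representatives {n} {N} f rep f∘rep = begin
  count isRep                    ≡⟨ sym (length-truePositions isRep) ⟩
  length (truePositions isRep)   ≡⟨ ≤-antisym (unique⊆⇒length≤ (unique-truePositions isRep) reps⊆image)
                                              (unique⊆⇒length≤ unique-image image⊆reps) ⟩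
  length image                   ≡⟨ length-map rep (booleanVectors N) ⟩
  length (booleanVectors N)      ≡⟨ length-booleanVectors N ⟩
  2 ^ N                          ∎
  where
  open ≡-Reasoning
  isRep : Fin n → Bool
  isRep j = ⌊ rep (f j) F.≟ j ⌋
  image : List (Fin n)
  image = map rep (booleanVectors N)
  unique-image : Unique image
  unique-image = Uniq.map⁺ (λ {s} {t} e → trans (sym (f∘rep s)) (trans (cong f e) (f∘rep t)))
                           (unique-booleanVectors N)
  reps⊆image : ∀ {j} → j ∈ truePositions isRep → j ∈ image
  reps⊆image {j} j∈ = subst (_∈ image) (isYes-sound (rep (f j) F.≟ j) (∈-truePositions⁻ isRep j j∈))
                            (Mem.∈-map⁺ rep (∈-booleanVectors (f j)))
  image⊆reps : ∀ {j} → j ∈ image → j ∈ truePositions isRep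
  image⊆reps j∈ with Mem.∈-map⁻ rep j∈
  ... | s , _ , refl =
    ∈-truePositions⁺ isRep (rep s) (isYes-true (rep (f (rep s)) F.≟ rep s) (cong rep (f∘rep s)))

open +-*-Solver

-- Bernoulli's inequality (1 + 1/b)^q ≥ 1 + q/b, cleared of denominators.
bernoulli : ∀ b q → b ^ q * (b + q) ≤ b * suc b ^ q
bernoulli b zero = ≤-reflexive (solve 1 (λ b → con 1 :* (b :+ con 0) := b :* con 1) refl b)
bernoulli b (suc q) = begin
  b ^ suc q * (b + suc q)
    ≡⟨ solve 3 (λ b X q → b :* X :* (b :+ (con 1 :+ q)) := b :* (X :* (b :+ q)) :+ b :* X) refl b (b ^ q) q ⟩
  b * (b ^ q * (b + q)) + b * b ^ q
    ≤⟨ +-mono-≤ (*-monoʳ-≤ b (bernoulli b q)) (*-monoʳ-≤ b (^-monoˡ-≤ q (n≤1+n b))) ⟩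
  b * (b * suc b ^ q) + b * suc b ^ q
    ≡⟨ solve 2 (λ b Y → b :* (b :* Y) :+ b :* Y := b :* (Y :+ b :* Y)) refl b (suc b ^ q) ⟩
  b * suc b ^ suc q ∎
  where open ≤-Reasoning

-- (1 + 1/b)^(b+1) ≥ 2, the case q = b + 1 of Bernoulli's inequality.
power-doubling : ∀ b → 2 * b ^ suc b ≤ suc b ^ suc b
power-doubling zero = z≤n
power-doubling b@(suc _) = *-cancelˡ-≤ b (begin
  b * (2 * b ^ suc b)      ≡⟨ solve 2 (λ b X → b :* (con 2 :* X) := X :* (b :+ b)) refl b (b ^ suc b) ⟩
  b ^ suc b * (b + b)      ≤⟨ *-monoʳ-≤ (b ^ suc b) (+-monoʳ-≤ b (n≤1+n b)) ⟩
  b ^ suc b * (b + suc b)  ≤⟨ bernoulli b (suc b) ⟩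
  b * suc b ^ suc b        ∎)
  where open ≤-Reasoning

*-^-distrib : ∀ x y q → (x * y) ^ q ≡ x ^ q * y ^ q
*-^-distrib x y zero    = refl
*-^-distrib x y (suc q) = trans (cong (x * y *_) (*-^-distrib x y q))
  (solve 4 (λ x y X Y → x :* y :* (X :* Y) := x :* X :* (y :* Y)) refl x y (x ^ q) (y ^ q))

-- Squaring power-doubling: (1 + 1/b)^(2(b+1)) ≥ 4.
power-quadrupling : ∀ b → 4 * b ^ (suc b + suc b) ≤ suc b ^ (suc b + suc b)
power-quadrupling b = begin
  4 * b ^ (suc b + suc b)                 ≡⟨ cong (4 *_) (^-distribˡ-+-* b (suc b) (suc b)) ⟩
  4 * (X * X)
    ≡⟨ solve 1 (λ X → con 4 :* (X :* X) := (con 2 :* X) :* (con 2 :* X)) refl X ⟩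
  (2 * X) * (2 * X)                       ≤⟨ *-mono-≤ (power-doubling b) (power-doubling b) ⟩
  suc b ^ suc b * suc b ^ suc b           ≡⟨ sym (^-distribˡ-+-* (suc b) (suc b) (suc b)) ⟩
  suc b ^ (suc b + suc b)                 ∎
  where
  open ≤-Reasoning
  X : ℕ
  X = b ^ suc b

-- With M = 2^N = b + 1 and q = 2M: at most M (M-1)^n objects, for n ≥ N q, satisfy
-- ℓ^q 2^n ≤ 2^(N n q).  Indeed M^q ≤ 2^n absorbs the factor M^q, and 4 (M-1)^q ≤ M^q.
counting-estimate : ∀ N b n ℓ → suc b ≡ 2 ^ N → N * (suc b + suc b) ≤ n →
  ℓ ≤ suc b * b ^ n → ℓ ^ (suc b + suc b) * 2 ^ (1 * n) ≤ 2 ^ (N * n * (suc b + suc b))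
counting-estimate N b n ℓ M≡2^N n≥Nq ℓ≤ = begin
  ℓ ^ q * 2 ^ (1 * n)             ≡⟨ cong (λ t → ℓ ^ q * 2 ^ t) (*-identityˡ n) ⟩
  ℓ ^ q * 2 ^ n                   ≤⟨ *-monoˡ-≤ (2 ^ n) (^-monoˡ-≤ q ℓ≤) ⟩
  (M * b ^ n) ^ q * 2 ^ n         ≡⟨ cong (_* 2 ^ n) expand ⟩
  M ^ q * (b ^ q) ^ n * 2 ^ n     ≤⟨ *-monoˡ-≤ (2 ^ n) (*-monoˡ-≤ ((b ^ q) ^ n) M^q≤2^n) ⟩
  2 ^ n * (b ^ q) ^ n * 2 ^ n     ≡⟨ regroup ⟩
  (4 * b ^ q) ^ n                 ≤⟨ ^-monoˡ-≤ n (power-quadrupling b) ⟩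
  (M ^ q) ^ n                     ≡⟨ cong (λ t → (t ^ q) ^ n) M≡2^N ⟩
  ((2 ^ N) ^ q) ^ n               ≡⟨ to-exponent ⟩
  2 ^ (N * n * q)                 ∎
  where
  open ≤-Reasoning
  q M : ℕ
  q = suc b + suc b
  M = suc b
  expand : (M * b ^ n) ^ q ≡ M ^ q * (b ^ q) ^ n
  expand = trans (*-^-distrib M (b ^ n) q) (cong (M ^ q *_)
             (trans (^-*-assoc b n q) (trans (cong (b ^_) (*-comm n q)) (sym (^-*-assoc b q n)))))
  regroup : 2 ^ n * (b ^ q) ^ n * 2 ^ n ≡ (4 * b ^ q) ^ n
  regroup = begin-equality
    2 ^ n * (b ^ q) ^ n * 2 ^ n     ≡⟨ solve 2 (λ T Y → T :* Y :* T := (T :* T) :* Y) refl (2 ^ n) ((b ^ q) ^ n) ⟩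
    (2 ^ n * 2 ^ n) * (b ^ q) ^ n   ≡⟨ cong (_* (b ^ q) ^ n) (sym (*-^-distrib 2 2 n)) ⟩
    4 ^ n * (b ^ q) ^ n             ≡⟨ sym (*-^-distrib 4 (b ^ q) n) ⟩
    (4 * b ^ q) ^ n                 ∎
  to-exponent : ((2 ^ N) ^ q) ^ n ≡ 2 ^ (N * n * q)
  to-exponent = trans (^-*-assoc (2 ^ N) q n) (trans (^-*-assoc 2 N (q * n))
    (cong (2 ^_) (solve 3 (λ N q n → N :* (q :* n) := N :* n :* q) refl N q n)))
  M^q≤2^n : M ^ q ≤ 2 ^ n
  M^q≤2^n = subst (_≤ 2 ^ n) (sym (trans (cong (_^ q) M≡2^N) (^-*-assoc 2 N q))) (^-monoʳ-≤ 2 n≥Nq)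

column : ∀ {N n} → Graph (N + n) → Fin n → Vec Bool N
column {N} {n} G j = tabulate (λ a → adj G (a ↑ˡ n) (N ↑ʳ j))

fromColumns : ∀ {N n} → Vec (Vec Bool N) n → BipGraph N n
fromColumns cs = tabulate λ a → tabulate λ j → lookup (lookup cs j) a

crossPart-columns : ∀ {N n} (G : Graph (N + n)) →
  crossPart {N} {n} G ≡ fromColumns (tabulate (column G))
crossPart-columns {N} {n} G = tabulate-cong λ a → tabulate-cong λ j →
  sym (trans (cong (λ v → lookup v a) (lookup∘tabulate (column G) j)) (lookup∘tabulate _ a))

allBut : ∀ {N} → Vec Bool N → List (Vec Bool N)
allBut {N} s = filter (λ t → ¬? (t ≟V s)) (booleanVectors N)

length-allBut : ∀ {N} (s : Vec Bool N) → suc (length (allBut s)) ≤ 2 ^ N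
length-allBut {N} s = subst (suc (length (allBut s)) ≤_) (length-booleanVectors N)
  (filter-notAll (λ t → ¬? (t ≟V s)) (booleanVectors N)
                 (Any.map (λ s≡t ¬t≡s → ¬t≡s (sym s≡t)) (∈-booleanVectors s)))

missingColumn : ∀ N n → List (BipGraph N n)
missingColumn N n = concat (map (λ s → map fromColumns (vectorsOver (allBut s) n)) (booleanVectors N))

length-missingColumn : ∀ N n b → suc b ≡ 2 ^ N → length (missingColumn N n) ≤ suc b * b ^ n
length-missingColumn N n b M≡2^N =
  subst (λ t → length (missingColumn N n) ≤ t * b ^ n) (trans (length-booleanVectors N) (sym M≡2^N))
    (length-concat-map≤ _ (booleanVectors N) (b ^ n) λ s →
      subst (_≤ b ^ n) (sym (trans (length-map fromColumns (vectorsOver (allBut s) n))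
                                   (length-vectorsOver (allBut s) n)))
        (^-monoˡ-≤ n (s≤s⁻¹ (subst (suc (length (allBut s)) ≤_) (sym M≡2^N) (length-allBut s)))))

crossPart∈missingColumn : ∀ {N n} (G : Graph (N + n)) (s : Vec Bool N) →
  (∀ j → column G j ≢ s) → crossPart {N} {n} G ∈ missingColumn N n
crossPart∈missingColumn {N} {n} G s s-missing = subst (_∈ missingColumn N n) (sym (crossPart-columns G))
  (Mem.∈-concat⁺′ (Mem.∈-map⁺ fromColumns (∈-vectorsOver (allBut s) (tabulate (column G)) λ j →
      subst (_∈ allBut s) (sym (lookup∘tabulate (column G) j))
        (Mem.∈-filter⁺ (λ t → ¬? (t ≟V s)) (∈-booleanVectors (column G j)) (s-missing j))))
    (Mem.∈-map⁺ (λ s → map fromColumns (vectorsOver (allBut s) n)) (∈-booleanVectors s)))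

fresh : ∀ {r} → Bool → Maybe (Fin (suc r))
fresh {r} b = if b then just (fromℕ r) else nothing

inCls-inject₁ : ∀ {r} (x i : Fin r) → inCls (just (inject₁ x)) (inject₁ i) ≡ inCls (just x) i
inCls-inject₁ x i = isYes-cong (inject₁ x F.≟ inject₁ i) (x F.≟ i) inject₁-injective (cong inject₁)

inCls-inject₁-new : ∀ {r} (x : Fin r) → inCls (just (inject₁ x)) (fromℕ r) ≡ false
inCls-inject₁-new x = isYes-false (inject₁ x F.≟ fromℕ _) (fromℕ≢inject₁ ∘ sym)

earlier-inject₁ : ∀ {r} (x i : Fin r) → earlier (just (inject₁ x)) (inject₁ i) ≡ earlier (just x) i
earlier-inject₁ x i = isYes-cong (toℕ (inject₁ x) <? toℕ (inject₁ i)) (toℕ x <? toℕ i)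
  (subst₂ _<_ (toℕ-inject₁ x) (toℕ-inject₁ i))
  (subst₂ _<_ (sym (toℕ-inject₁ x)) (sym (toℕ-inject₁ i)))

earlier-inject₁-new : ∀ {r} (x : Fin r) → earlier (just (inject₁ x)) (fromℕ r) ≡ true
earlier-inject₁-new {r} x = isYes-true (toℕ (inject₁ x) <? toℕ (fromℕ r))
  (subst₂ _<_ (sym (toℕ-inject₁ x)) (sym (toℕ-fromℕ r)) (toℕ<n x))

inCls-fresh-old : ∀ {r} b (i : Fin r) → inCls (fresh b) (inject₁ i) ≡ false
inCls-fresh-old true  i = isYes-false (fromℕ _ F.≟ inject₁ i) fromℕ≢inject₁
inCls-fresh-old false i = refl

inCls-fresh-new : ∀ {r} b → inCls (fresh {r} b) (fromℕ r) ≡ b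
inCls-fresh-new true  = isYes-true (fromℕ _ F.≟ fromℕ _) refl
inCls-fresh-new false = refl

-- The new class is the last one, so its vertices lie before no class.
earlier-fresh : ∀ {r} b (i : Fin (suc r)) → earlier (fresh b) i ≡ false
earlier-fresh true  i = isYes-false (toℕ (fromℕ _) <? toℕ i) (≤⇒≯ (≤fromℕ i))
earlier-fresh false i = refl

module Extension {N n r : ℕ} (G : Graph (N + n)) (c : Fin N → Fin r) (new : Fin n → Bool) where

  cls : Fin (N + n) → Maybe (Fin (suc r))
  cls v = [ (λ a → just (inject₁ (c a))) , (λ j → fresh (new j)) ]′ (splitAt N v)

  cls-A : ∀ a → cls (a ↑ˡ n) ≡ just (inject₁ (c a))
  cls-A a rewrite splitAt-↑ˡ N a n = refl

  cls-B : ∀ j → cls (N ↑ʳ j) ≡ fresh (new j)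
  cls-B j rewrite splitAt-↑ʳ N n j = refl

  count-cls : (P : Maybe (Fin (suc r)) → Bool) (onA : Fin N → Bool) (onB : Fin n → Bool) →
    (∀ a → P (just (inject₁ (c a))) ≡ onA a) → (∀ j → P (fresh (new j)) ≡ onB j) →
    count (λ v → P (cls v)) ≡ count onA + count onB
  count-cls P onA onB A≗ B≗ = trans (count-+ N (P ∘ cls))
    (cong₂ _+_ (count-cong _ onA (λ a → trans (cong P (cls-A a)) (A≗ a)))
               (count-cong _ onB (λ j → trans (cong P (cls-B j)) (B≗ j))))

  size-old : ∀ i → count (λ v → inCls (cls v) (inject₁ i)) ≡ count (λ a → inCls (just (c a)) i)
  size-old i = trans (count-cls (λ m → inCls m (inject₁ i)) _ (λ _ → false)
                                (λ a → inCls-inject₁ (c a) i) (λ j → inCls-fresh-old (new j) i))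
                     (trans (cong (_ +_) (count-false n)) (+-identityʳ _))

  before-old : ∀ i → count (λ v → earlier (cls v) (inject₁ i)) ≡ count (λ a → earlier (just (c a)) i)
  before-old i = trans (count-cls (λ m → earlier m (inject₁ i)) _ (λ _ → false)
                                  (λ a → earlier-inject₁ (c a) i) (λ j → earlier-fresh (new j) _))
                       (trans (cong (_ +_) (count-false n)) (+-identityʳ _))

  size-new : count (λ v → inCls (cls v) (fromℕ r)) ≡ count new
  size-new = trans (count-cls (λ m → inCls m (fromℕ r)) (λ _ → false) new
                              (λ a → inCls-inject₁-new (c a)) (λ j → inCls-fresh-new (new j)))
                   (cong (_+ count new) (count-false N))

  before-new : count (λ v → earlier (cls v) (fromℕ r)) ≡ N
  before-new = trans (count-cls (λ m → earlier m (fromℕ r)) (λ _ → true) (λ _ → false)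
                                (λ a → earlier-inject₁-new (c a)) (λ j → earlier-fresh (new j) _))
                     (trans (cong₂ _+_ (count-true N) (count-false n)) (+-identityʳ N))

  -- Classes before inject₁ i contain only A-vertices, whose position is unchanged.
  earlier-A : ∀ a i → earlier (cls (a ↑ˡ n)) (inject₁ i) ≡ earlier (just (c a)) i
  earlier-A a i = trans (cong (λ m → earlier m (inject₁ i)) (cls-A a)) (earlier-inject₁ (c a) i)

  B-not-earlier : ∀ j i → earlier (cls (N ↑ʳ j)) i ≢ true
  B-not-earlier j i = not-¬ (trans (cong (λ m → earlier m i) (cls-B j)) (earlier-fresh (new j) i))

  arrow-old : ∀ i → Arrow (adjA {N} {n} G) (just ∘ c) i → Arrow (adj G) cls (inject₁ i)
  arrow-old i arrowA S S⊆
    with arrowA (λ a → S (a ↑ˡ n)) (λ a e → trans (sym (earlier-A a i)) (S⊆ (a ↑ˡ n) e))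
  ... | x , x∈ , x-agrees =
    x ↑ˡ n ,
    trans (cong (λ m → inCls m (inject₁ i)) (cls-A x)) (trans (inCls-inject₁ (c x) i) x∈) ,
    +-elim N (λ v → earlier (cls v) (inject₁ i) ≡ true → adj G (x ↑ˡ n) v ≡ S v)
      (λ a e → x-agrees a (trans (sym (earlier-A a i)) e))
      (λ j e → ⊥-elim (B-not-earlier j (inject₁ i) e))

  arrow-new : (rep : Vec Bool N → Fin n) → (∀ s → new (rep s) ≡ true) →
    (∀ s → column G (rep s) ≡ s) → Arrow (adj G) cls (fromℕ r)
  arrow-new rep rep-new rep-column S _ = N ↑ʳ rep s , rep∈new ,
    +-elim N (λ v → earlier (cls v) (fromℕ r) ≡ true → adj G (N ↑ʳ rep s) v ≡ S v)
      (λ a _ → begin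
        adj G (N ↑ʳ rep s) (a ↑ˡ n)    ≡⟨ Graph.sym G _ _ ⟩
        adj G (a ↑ˡ n) (N ↑ʳ rep s)    ≡⟨ sym (lookup∘tabulate _ a) ⟩
        lookup (column G (rep s)) a    ≡⟨ cong (λ v → lookup v a) (rep-column s) ⟩
        lookup s a                     ≡⟨ lookup∘tabulate _ a ⟩
        S (a ↑ˡ n)                     ∎)
      (λ j e → ⊥-elim (B-not-earlier j (fromℕ r) e))
    where
    open ≡-Reasoning
    s : Vec Bool N
    s = tabulate (λ a → S (a ↑ˡ n))
    rep∈new : inCls (cls (N ↑ʳ rep s)) (fromℕ r) ≡ true
    rep∈new = trans (cong (λ m → inCls m (fromℕ r)) (cls-B (rep s)))
                    (trans (inCls-fresh-new (new (rep s))) (rep-new s))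

-- If G[A] carries U(r+1,k) with classes c and every vector of {0,1}^N occurs
-- as a column of G[A,B], then one representative per vector forms a new class of size
-- 2^N that arrows onto A, so G contains U(r+2,k).
universal-columns⇒copy : ∀ {N n r k} (G : Graph (N + n)) (c : Fin N → Fin (suc r)) →
  IsUCopy (suc r) k (adjA {N} {n} G) (just ∘ c) → (∀ s → ∃ λ j → column G j ≡ s) →
  Σ (Fin (N + n) → Maybe (Fin (suc (suc r)))) (IsUCopy (suc (suc r)) k (adj G))
universal-columns⇒copy {N} {n} {r} {k} G c (first-class , later-classes) covers =
  cls , first-class′ , later-classes′
  where
  rep : Vec Bool N → Fin n
  rep s = proj₁ (covers s)
  rep-column : ∀ s → column G (rep s) ≡ s
  rep-column s = proj₂ (covers s)
  isRep : Fin n → Bool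
  isRep j = ⌊ rep (column G j) F.≟ j ⌋
  rep-isRep : ∀ s → isRep (rep s) ≡ true
  rep-isRep s = isYes-true (rep (column G (rep s)) F.≟ rep s) (cong rep (rep-column s))
  open Extension G c isRep

  first-class′ : ∀ i → toℕ i ≡ 0 → count (λ v → inCls (cls v) i) ≡ k
  first-class′ i i≡0 with view i
  ... | ‵fromℕ with trans (sym (toℕ-fromℕ (suc r))) i≡0
  ...   | ()
  first-class′ i i≡0 | ‵inject₁ i' =
    trans (size-old i') (first-class i' (trans (sym (toℕ-inject₁ i')) i≡0))

  later-classes′ : ∀ i → 0 < toℕ i →
    (count (λ v → inCls (cls v) i) ≡ 2 ^ count (λ v → earlier (cls v) i)) × Arrow (adj G) cls i
  later-classes′ i 0<i with view i
  ... | ‵fromℕ =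
    trans size-new (trans (count-representatives (column G) rep rep-column) (cong (2 ^_) (sym before-new))) ,
    arrow-new rep rep-isRep rep-column
  ... | ‵inject₁ i' with later-classes i' (subst (0 <_) (toℕ-inject₁ i') 0<i)
  ...   | size≡ , arrow =
    trans (size-old i') (trans size≡ (cong (2 ^_) (sym (before-old i')))) , arrow-old i' arrow

-- Every H ∈ 𝒢(r+1,k,n) misses a column, since otherwise G would contain U(r+2,k).
family⊆missingColumn : ∀ r k n H → InFamily (suc r) k n H → H ∈ missingColumn (Usize (suc r) k) n
family⊆missingColumn r k n H (G , (c , copyA , _) , free , G[A,B]≡H)
  with surjective-or-misses (column {Usize (suc r) k} {n} G)
... | inj₁ covers        = ⊥-elim (free (universal-columns⇒copy G c copyA covers))
... | inj₂ (s , missing) = subst (_∈ missingColumn _ n) G[A,B]≡H (crossPart∈missingColumn G s missing)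

count-initial : ∀ {m} k → k ≤ m → count {m} (λ v → ⌊ toℕ v <? k ⌋) ≡ k
count-initial {m} zero _ = trans (count-cong {m} _ _ (λ v → isYes-false (toℕ v <? 0) λ ())) (count-false m)
count-initial {suc m} (suc k) (s≤s k≤m) =
  cong₂ _+_ (cong (λ b → if b then 1 else 0) (isYes-true (0 <? suc k) (s≤s z≤n)))
            (trans (count-cong {m} _ _ (λ v → isYes-cong (suc (toℕ v) <? suc k) (toℕ v <? k) s≤s⁻¹ s≤s))
                   (count-initial k k≤m))

-- U(1,k) is just k vertices, so 𝒢(0,k,n) is empty as soon as n ≥ k.
family-empty : ∀ k n H → k ≤ n → ¬ InFamily 0 k n H
family-empty k n H k≤n (G , _ , free , _) = free (cls , first-class , λ { F.zero () })
  where
  cls : Fin n → Maybe (Fin 1)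
  cls v = if ⌊ toℕ v <? k ⌋ then just F.zero else nothing
  in-first : ∀ v → inCls (cls v) F.zero ≡ ⌊ toℕ v <? k ⌋
  in-first v with ⌊ toℕ v <? k ⌋
  ... | true  = refl
  ... | false = refl
  first-class : ∀ (i : Fin 1) → toℕ i ≡ 0 → count (λ v → inCls (cls v) i) ≡ k
  first-class F.zero _ = trans (count-cong _ _ in-first) (count-initial k k≤n)

lemma9 : (r k : ℕ) →
    ∃ λ (K : ℕ) → ∃ λ (p : ℕ) → ∃ λ (q : ℕ) → 1 ≤ p × 1 ≤ q ×
      ((n : ℕ) → K ≤ n →
        (L : List (BipGraph (Usize r k) n)) → Unique L → All (InFamily r k n) L →
        length L ^ q * 2 ^ (p * n) ≤ 2 ^ (Usize r k * n * q))
lemma9 zero k = k , 1 , 1 , s≤s z≤n , s≤s z≤n , bound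
  where
  bound : ∀ n → k ≤ n → (L : List (BipGraph 0 n)) → Unique L → All (InFamily 0 k n) L →
    length L ^ 1 * 2 ^ (1 * n) ≤ 2 ^ (0 * n * 1)
  bound n k≤n []      _ _          = z≤n
  bound n k≤n (H ∷ L) _ (H∈ ∷ _) = ⊥-elim (family-empty k n H k≤n H∈)
lemma9 (suc r) k = N * q , 1 , q , s≤s z≤n , s≤s z≤n , λ n n≥Nq L L! L⊆family →
  counting-estimate N b n (length L) M≡2^N n≥Nq
    (≤-trans (unique⊆⇒length≤ L! (family⊆missingColumn r k n _ ∘ All.lookup L⊆family))
             (length-missingColumn N n b M≡2^N))
  where
  N b q : ℕ
  N = Usize (suc r) k
  b = pred (2 ^ N)
  q = suc b + suc b
  M≡2^N : suc b ≡ 2 ^ N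
  M≡2^N = suc-pred (2 ^ N) {{m^n≢0 2 N}}
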